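{- Let $p>3$ be prime and $\mathbb{F}$ a finite extension of $\mathbb{F}_p$. For $i,j\in\{1,2\}$ and $a,b,c,\alpha,\beta,\gamma\in\mathbb{F}^\times$, the Breuil module $\mathcal{M}(s^i,a,b,c)$ is isomorphic to $\mathcal{M}(s^j,\alpha,\beta,\gamma)$ if and only if $i=j$ and $abc=\alpha\beta\gamma$.
   Context: Let $\mathcal{F}=\mathbb{F}[u]/u^p$. A Breuil module of weight $2$ with $\mathbb{F}$-coefficients is a quadruple $(\mathcal{M},\mathcal{M}_2,\varphi_2,N)$: $\mathcal{M}$ a free $\mathcal{F}$-module of finite rank, $\mathcal{M}_2\supset u^2\mathcal{M}$ an $\mathcal{F}$-submodule, $\varphi_2:\mathcal{M}_2\to\mathcal{M}$ $\mathbb{F}$-linear and semilinear for the $p$-th power map on $\mathbb{F}_p[u]/u^p$ with image generating $\mathcal{M}$, and $N:\mathcal{M}\to\mathcal{M}$ $\mathbb{F}$-linear with $N(ux)=uN(x)-ux$, $uN(\mathcal{M}_2)\subset\mathcal{M}_2$, $\varphi_2(uN(x))=cN(\varphi_2(x))$ ($c$ the image of $\varphi(u-p)/p$). Morphisms are $\mathcal{F}$-linear maps preserving $\mathcal{M}_2$ and commuting with $\varphi_2,N$. Let $s=(1\,2\,3)\in S_3$. $\mathcal{M}(s^i,a,b,c)$ is defined by $\mathcal{M}=\mathcal{F}E_1\oplus\mathcal{F}E_2\oplus\mathcal{F}E_3$, $\mathcal{M}_2=\mathcal{F}(u^2E_1,uE_2,E_3)$, $\varphi_2(u^2E_1)=aE_{s^i(1)}$,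 $\varphi_2(uE_2)=bE_{s^i(2)}$, $\varphi_2(E_3)=cE_{s^i(3)}$, $N(E_k)=0$ for all $k$. -}

module Defs where

open import Level using (Level; _⊔_) renaming (suc to lsuc)
open import Algebra.Bundles using (CommutativeRing)
open import Data.Nat as ℕ using (ℕ; zero; suc; _∸_)
open import Data.Fin as Fin using (Fin; toℕ)
open import Data.Fin.Properties using (_≟_)
open import Data.List using (List; foldr; map; upTo)
open import Data.Product using (Σ; ∃; _×_)
open import Data.Bool using (if_then_else_)
open import Relation.Nullary using (¬_)
open import Relation.Nullary.Decidable using (⌊_⌋)

smul : {c ℓ : Level} (R : CommutativeRing c ℓ) → ℕ → CommutativeRing.Carrier R → CommutativeRing.Carrier R
smul R zero x = CommutativeRing.0# R
smul R (suc n) x = CommutativeRing._+_ R x (smul R n x)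

-- A finite field of characteristic p (= a finite extension of 𝔽_p when p is prime).
record FiniteField (p : ℕ) (c ℓ : Level) : Set (lsuc (c ⊔ ℓ)) where
  field
    cring : CommutativeRing c ℓ
  open CommutativeRing cring public
  _•_ : ℕ → Carrier → Carrier
  _•_ = smul cring
  field
    1≉0      : ¬ (1# ≈ 0#)
    inverse  : ∀ x → ¬ (x ≈ 0#) → ∃ λ y → x * y ≈ 1#
    charp    : p • 1# ≈ 0#
    finite   : ∃ λ n → Σ (Fin n → Carrier) λ e → ∀ x → ∃ λ k → e k ≈ x

module Breuil {c ℓ : Level} (p : ℕ) (F : FiniteField p c ℓ) where
  open FiniteField F

  -- elements of 𝓕 = F[u]/u^p : coefficient of u^m for m < p
  𝓕 : Set c
  𝓕 = Fin p → Carrier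

  coef : 𝓕 → ℕ → Carrier
  coef f m with m ℕ.<? p
  ... | Relation.Nullary.yes m<p = f (Fin.fromℕ< m<p)
  ... | Relation.Nullary.no  _   = 0#

  Σ≤ : ℕ → (ℕ → Carrier) → Carrier
  Σ≤ n g = foldr _+_ 0# (map g (upTo (suc n)))

  _·_ : 𝓕 → 𝓕 → 𝓕
  (f · g) m = Σ≤ (toℕ m) (λ i → coef f i * coef g (toℕ m ∸ i))

  const : Carrier → 𝓕
  const x m = if ⌊ toℕ m ℕ.≟ 0 ⌋ then x else 0#

  _⊕_ : 𝓕 → 𝓕 → 𝓕
  (f ⊕ g) m = f m + g m

  -- 𝓜 = 𝓕E₁ ⊕ 𝓕E₂ ⊕ 𝓕E₃  (index 0,1,2 ↔ E₁,E₂,E₃)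
  𝓜 : Set c
  𝓜 = Fin 3 → 𝓕

  _≋_ : 𝓜 → 𝓜 → Set ℓ
  x ≋ y = ∀ k m → x k m ≈ y k m

  -- 𝓜₂ = 𝓕(u²E₁, uE₂, E₃)
  In𝓜₂ : 𝓜 → Set ℓ
  In𝓜₂ x = (coef (x Fin.zero) 0 ≈ 0#) × (coef (x Fin.zero) 1 ≈ 0#)
         × (coef (x (Fin.suc Fin.zero)) 0 ≈ 0#)

  s : Fin 3 → Fin 3
  s Fin.zero = Fin.suc Fin.zero
  s (Fin.suc Fin.zero) = Fin.suc (Fin.suc Fin.zero)
  s (Fin.suc (Fin.suc Fin.zero)) = Fin.zero

  s^ : ℕ → Fin 3 → Fin 3
  s^ zero k = k
  s^ (suc i) k = s (s^ i k)

  -- φ₂ of 𝓜(s^i,a,b,c): the unique F-linear, (u ↦ u^p = 0)-semilinear map with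
  -- φ₂(u²E₁)=aE_{s^i(1)}, φ₂(uE₂)=bE_{s^i(2)}, φ₂(E₃)=cE_{s^i(3)}.
  -- For x = f₁u²E₁ + f₂uE₂ + f₃E₃ one gets φ₂(x) = f₁(0)aE_{s^i(1)} + f₂(0)bE_{s^i(2)} + f₃(0)cE_{s^i(3)}.
  φ₂ : ℕ → Carrier → Carrier → Carrier → 𝓜 → 𝓜
  φ₂ i a b c' x k = const (term Fin.zero + (term (Fin.suc Fin.zero) + term (Fin.suc (Fin.suc Fin.zero))))
    where
    w : Fin 3 → Carrier
    w Fin.zero = coef (x Fin.zero) 2 * a
    w (Fin.suc Fin.zero) = coef (x (Fin.suc Fin.zero)) 1 * b
    w (Fin.suc (Fin.suc Fin.zero)) = coef (x (Fin.suc (Fin.suc Fin.zero))) 0 * c'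
    term : Fin 3 → Carrier
    term l = if ⌊ s^ i l ≟ k ⌋ then w l else 0#

  -- N with N(E_k)=0, N F-linear, N(ux)=uN(x)-ux;  hence N(u^m E_k) = -m u^m E_k.
  N : 𝓜 → 𝓜
  N x k m = - (toℕ m • x k m)

  -- 𝓕-linear maps 𝓜 → 𝓜 as matrices: f(E_l) = Σ_k A k l E_k
  Mat : Set c
  Mat = Fin 3 → Fin 3 → 𝓕

  app : Mat → 𝓜 → 𝓜
  app A x k = ((A k Fin.zero · x Fin.zero) ⊕ (A k (Fin.suc Fin.zero) · x (Fin.suc Fin.zero)))
              ⊕ (A k (Fin.suc (Fin.suc Fin.zero)) · x (Fin.suc (Fin.suc Fin.zero)))

  IsMorphism : (i : ℕ) (a b c' : Carrier) (j : ℕ) (α β γ : Carrier) → Mat → Set (c ⊔ ℓ)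
  IsMorphism i a b c' j α β γ A =
      (∀ x → In𝓜₂ x → In𝓜₂ (app A x))
    × (∀ x → In𝓜₂ x → app A (φ₂ i a b c' x) ≋ φ₂ j α β γ (app A x))
    × (∀ x → app A (N x) ≋ N (app A x))

  Isomorphic : (i : ℕ) (a b c' : Carrier) (j : ℕ) (α β γ : Carrier) → Set (c ⊔ ℓ)
  Isomorphic i a b c' j α β γ =
    ∃ λ (A : Mat) → ∃ λ (B : Mat) →
        IsMorphism i a b c' j α β γ A
      × IsMorphism j α β γ i a b c' B
      × (∀ x → app B (app A x) ≋ x)
      × (∀ x → app A (app B x) ≋ x)

module Submission where

-- Write w = (a,b,c') and ω = (α,β,γ). 𝓜₂ is generated by the vectors u^(deg l) E_l
-- with deg = (2,1,0), and φ₂ sends u^(deg l) E_l to w_l E_{s^i(l)}.  Everything is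
-- controlled by constant terms of matrices over 𝓕 = F[u]/u^p (p ≥ 3):
--  * a matrix preserving 𝓜₂ has triangular constant terms, so for an isomorphism
--    A (inverse B) the diagonal constants d_l = A_ll(0) are units;
--  * comparing A ∘ φ₂ with φ₂ ∘ A on u^(deg l) E_l gives d_{s^i(l)} w_l = d_l ω_l when
--    i = j (multiplying over l: abc' = αβγ), while for i ≠ j the generator u²E₁ is sent
--    to a coordinate of lower degree, forcing a = 0;
--  * conversely, if abc' = αβγ the ratios ω_l / w_l have product 1 along the 3-cycle
--    s^i, hence are a coboundary d_{s^i(l)} / d_l, and diag(d) is an isomorphism.

open import Defs
open import Data.Nat using (ℕ; _>_; _≤_)
open import Data.Nat.Primality using (Prime)
open import Data.Product using (_×_)
open import Relation.Binary.PropositionalEquality using (_≡_)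
open import Relation.Nullary using (¬_)
open import Level using (Level)

open import Data.Nat as ℕ using (zero; suc; _∸_; _<_; z≤n; s≤s; s≤s⁻¹)
open import Data.Nat.Properties
  using (<-irrefl; <-trans; ≤-<-trans; <-cmp; m∸n≤m; ∸-monoʳ-<; *-suc) renaming (+-comm to ℕ-+-comm)
open import Data.Fin as Fin using (Fin; toℕ; fromℕ<)
open import Data.Fin.Properties using (_≟_; toℕ-fromℕ<; fromℕ<-toℕ; toℕ<n)
open import Data.List using (foldr; map; applyUpTo)
open import Data.Product using (Σ; _,_; proj₁; proj₂)
open import Data.Sum using (_⊎_; inj₁; inj₂)
open import Data.Empty using (⊥-elim)
open import Data.Bool using (if_then_else_)
open import Relation.Nullary using (yes; no)
open import Relation.Nullary.Decidable using (⌊_⌋)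
open import Relation.Binary.Definitions using (tri<; tri≈; tri>)
open import Relation.Binary.PropositionalEquality as ≡ using (_≢_; cong)

OneOrTwo : ℕ → Set
OneOrTwo i = i ≡ 1 ⊎ i ≡ 2

oneOrTwo : ∀ {i} → 1 ≤ i → i ≤ 2 → OneOrTwo i
oneOrTwo {1} _ _ = inj₁ ≡.refl
oneOrTwo {2} _ _ = inj₂ ≡.refl
oneOrTwo {suc (suc (suc _))} _ (s≤s (s≤s ()))

pattern ι₁ = Fin.zero
pattern ι₂ = Fin.suc Fin.zero
pattern ι₃ = Fin.suc (Fin.suc Fin.zero)

module Development {c ℓ : Level} (q : ℕ) (F : FiniteField (suc (suc (suc q))) c ℓ) where
  open FiniteField F
  open Breuil (suc (suc (suc q))) F
  open import Relation.Binary.Reasoning.Setoid setoid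
  open import Algebra.Properties.CommutativeSemigroup *-commutativeSemigroup using (interchange; x∙yz≈y∙xz)
  open import Algebra.Properties.Ring ring using (-‿distribʳ-*)
  open import Algebra.Properties.Semiring.Mult semiring using (×-comm-*; ×-congʳ) renaming (_×_ to _×ᴿ_)
  open import Algebra.Solver.Ring.NaturalCoefficients.Default commutativeSemiring

  p : ℕ
  p = suc (suc (suc q))

  _⁻¹⟨_⟩ : (x : Carrier) → ¬ (x ≈ 0#) → Carrier
  x ⁻¹⟨ x≉0 ⟩ = proj₁ (inverse x x≉0)

  ⁻¹-inverse : ∀ x (x≉0 : ¬ (x ≈ 0#)) → x * x ⁻¹⟨ x≉0 ⟩ ≈ 1#
  ⁻¹-inverse x x≉0 = proj₂ (inverse x x≉0)

  *-cancelˡ : ∀ {x y z} → ¬ (x ≈ 0#) → x * y ≈ x * z → y ≈ z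
  *-cancelˡ {x} {y} {z} x≉0 xy≈xz = begin
    y                ≈⟨ *-identityˡ y ⟨
    1# * y           ≈⟨ *-congʳ x⁻¹x≈1 ⟨
    (x⁻¹ * x) * y    ≈⟨ *-assoc x⁻¹ x y ⟩
    x⁻¹ * (x * y)    ≈⟨ *-congˡ xy≈xz ⟩
    x⁻¹ * (x * z)    ≈⟨ *-assoc x⁻¹ x z ⟨
    (x⁻¹ * x) * z    ≈⟨ *-congʳ x⁻¹x≈1 ⟩
    1# * z           ≈⟨ *-identityˡ z ⟩
    z                ∎
    where
    x⁻¹ : Carrier
    x⁻¹ = x ⁻¹⟨ x≉0 ⟩
    x⁻¹x≈1 : x⁻¹ * x ≈ 1#
    x⁻¹x≈1 = trans (*-comm x⁻¹ x) (⁻¹-inverse x x≉0)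

  no-zero-divisors : ∀ {x y} → ¬ (x ≈ 0#) → x * y ≈ 0# → y ≈ 0#
  no-zero-divisors {x} x≉0 xy≈0 = *-cancelˡ x≉0 (trans xy≈0 (sym (zeroʳ x)))

  nonzero-* : ∀ {x y} → ¬ (x ≈ 0#) → ¬ (y ≈ 0#) → ¬ (x * y ≈ 0#)
  nonzero-* x≉0 y≉0 xy≈0 = y≉0 (no-zero-divisors x≉0 xy≈0)

  unit⇒nonzero : ∀ {x y} → x * y ≈ 1# → ¬ (y ≈ 0#)
  unit⇒nonzero {x} xy≈1 y≈0 = 1≉0 (trans (sym xy≈1) (trans (*-congˡ y≈0) (zeroʳ x)))

  -- Sums and products over the three basis indices; Σ₃ is bracketed like 'app'.
  Σ₃ Π₃ : (Fin 3 → Carrier) → Carrier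
  Σ₃ g = (g ι₁ + g ι₂) + g ι₃
  Π₃ g = (g ι₁ * g ι₂) * g ι₃

  Σ₃-cong : ∀ {g h} → (∀ l → g l ≈ h l) → Σ₃ g ≈ Σ₃ h
  Σ₃-cong g≈h = +-cong (+-cong (g≈h ι₁) (g≈h ι₂)) (g≈h ι₃)

  Π₃-cong : ∀ {g h} → (∀ l → g l ≈ h l) → Π₃ g ≈ Π₃ h
  Π₃-cong g≈h = *-cong (*-cong (g≈h ι₁) (g≈h ι₂)) (g≈h ι₃)

  Π₃-* : ∀ f g → Π₃ (λ l → f l * g l) ≈ Π₃ f * Π₃ g
  Π₃-* f g = trans (*-congʳ (interchange _ _ _ _)) (interchange _ _ _ _)

  Π₃-nonzero : ∀ {f} → (∀ l → ¬ (f l ≈ 0#)) → ¬ (Π₃ f ≈ 0#)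
  Π₃-nonzero f≉0 = nonzero-* (nonzero-* (f≉0 ι₁) (f≉0 ι₂)) (f≉0 ι₃)

  Σ₃-concentrated : ∀ {g} l → (∀ l′ → l′ ≢ l → g l′ ≈ 0#) → Σ₃ g ≈ g l
  Σ₃-concentrated ι₁ off = trans (+-cong (+-congˡ (off ι₂ λ ())) (off ι₃ λ ()))
                                 (trans (+-identityʳ _) (+-identityʳ _))
  Σ₃-concentrated ι₂ off = trans (+-cong (+-congʳ (off ι₁ λ ())) (off ι₃ λ ()))
                                 (trans (+-identityʳ _) (+-identityˡ _))
  Σ₃-concentrated ι₃ off = trans (+-congʳ (+-cong (off ι₁ λ ()) (off ι₂ λ ())))
                                 (trans (+-congʳ (+-identityʳ _)) (+-identityˡ _))

  δ : {A : Set c} → Fin 3 → Fin 3 → A → A → A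
  δ l k x y = if ⌊ l ≟ k ⌋ then x else y

  δ-on : ∀ {A : Set c} {l k} {x y : A} → l ≡ k → δ l k x y ≡ x
  δ-on {l = l} {k} l≡k with l ≟ k
  ... | yes _ = ≡.refl
  ... | no l≢k = ⊥-elim (l≢k l≡k)

  δ-off : ∀ {A : Set c} {l k} {x y : A} → l ≢ k → δ l k x y ≡ y
  δ-off {l = l} {k} l≢k with l ≟ k
  ... | yes l≡k = ⊥-elim (l≢k l≡k)
  ... | no _ = ≡.refl

  -- Powers of the 3-cycle s: s^ is additive in the exponent and has period 3,
  -- so s^ (i * 2) inverts s^ i.
  s^-+ : ∀ m n k → s^ (m ℕ.+ n) k ≡ s^ m (s^ n k)
  s^-+ zero n k = ≡.refl
  s^-+ (suc m) n k = cong s (s^-+ m n k)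

  s³≡id : ∀ k → s (s (s k)) ≡ k
  s³≡id ι₁ = ≡.refl
  s³≡id ι₂ = ≡.refl
  s³≡id ι₃ = ≡.refl

  s^-period : ∀ n k → s^ (n ℕ.* 3) k ≡ k
  s^-period zero k = ≡.refl
  s^-period (suc n) k = ≡.trans (cong (λ l → s (s (s l))) (s^-period n k)) (s³≡id k)

  s^⁻¹ : ℕ → Fin 3 → Fin 3
  s^⁻¹ i = s^ (i ℕ.* 2)

  s^⁻¹-s^ : ∀ i l → s^⁻¹ i (s^ i l) ≡ l
  s^⁻¹-s^ i l = ≡.trans (≡.sym (s^-+ (i ℕ.* 2) i l))
    (≡.trans (cong (λ n → s^ n l) (≡.trans (ℕ-+-comm (i ℕ.* 2) i) (≡.sym (*-suc i 2))))
             (s^-period i l))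

  s^-s^⁻¹ : ∀ i k → s^ i (s^⁻¹ i k) ≡ k
  s^-s^⁻¹ i k = ≡.trans (≡.sym (s^-+ i (i ℕ.* 2) k))
    (≡.trans (cong (λ n → s^ n k) (≡.sym (*-suc i 2))) (s^-period i k))

  Π₃-s^ : ∀ i f → Π₃ (λ l → f (s^ i l)) ≈ Π₃ f
  Π₃-s^ zero f = refl
  Π₃-s^ (suc i) f = trans (Π₃-s^ i (λ l → f (s l)))
    (trans (*-comm _ _) (sym (*-assoc _ _ _)))

  infix 30 u^_
  u^_ : ℕ → 𝓕
  (u^ t) m = if ⌊ toℕ m ℕ.≟ t ⌋ then 1# else 0#

  𝟎 : 𝓕
  𝟎 _ = 0#

  u^-on : ∀ t m → toℕ m ≡ t → (u^ t) m ≈ 1#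
  u^-on t m m≡t with toℕ m ℕ.≟ t
  ... | yes _ = refl
  ... | no m≢t = ⊥-elim (m≢t m≡t)

  u^-off : ∀ t m → toℕ m ≢ t → (u^ t) m ≈ 0#
  u^-off t m m≢t with toℕ m ℕ.≟ t
  ... | yes m≡t = ⊥-elim (m≢t m≡t)
  ... | no _ = refl

  coef-< : ∀ f {n} (n<p : n < p) → coef f n ≡ f (fromℕ< n<p)
  coef-< f {n} n<p with n ℕ.<? p
  ... | yes _ = ≡.refl
  ... | no n≮p = ⊥-elim (n≮p n<p)

  coef-toℕ : ∀ f m → coef f (toℕ m) ≡ f m
  coef-toℕ f m = ≡.trans (coef-< f (toℕ<n m)) (cong f (fromℕ<-toℕ m (toℕ<n m)))

  coef-scale : ∀ {f g} x → (∀ m → f m ≈ x * g m) → ∀ n → coef f n ≈ x * coef g n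
  coef-scale x f≈xg n with n ℕ.<? p
  ... | yes n<p = f≈xg (fromℕ< n<p)
  ... | no _ = sym (zeroʳ x)

  coef-cong : ∀ {f g} → (∀ m → f m ≈ g m) → ∀ n → coef f n ≈ coef g n
  coef-cong f≈g n with n ℕ.<? p
  ... | yes n<p = f≈g (fromℕ< n<p)
  ... | no _ = refl

  coef-𝟎 : ∀ n → coef 𝟎 n ≈ 0#
  coef-𝟎 n with n ℕ.<? p
  ... | yes _ = refl
  ... | no _ = refl

  coef-u^-on : ∀ {t} → t < p → coef (u^ t) t ≈ 1#
  coef-u^-on {t} t<p = trans (reflexive (coef-< (u^ t) t<p)) (u^-on t _ (toℕ-fromℕ< t<p))

  coef-u^-off : ∀ {t n} → n ≢ t → coef (u^ t) n ≈ 0#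
  coef-u^-off {t} {n} n≢t with n ℕ.<? p
  ... | yes n<p = u^-off t _ (λ e → n≢t (≡.trans (≡.sym (toℕ-fromℕ< n<p)) e))
  ... | no _ = refl

  coef-const-suc : ∀ x n → coef (const x) (suc n) ≈ 0#
  coef-const-suc x n with suc n ℕ.<? p
  ... | yes _ = refl
  ... | no _ = refl

  sum-vanishes : ∀ (g : ℕ → Carrier) h n → (∀ k → k < n → g (h k) ≈ 0#) →
                 foldr _+_ 0# (map g (applyUpTo h n)) ≈ 0#
  sum-vanishes g h zero _ = refl
  sum-vanishes g h (suc n) g∘h≈0 =
    trans (+-cong (g∘h≈0 0 (s≤s z≤n)) (sum-vanishes g (λ k → h (suc k)) n (λ k k<n → g∘h≈0 (suc k) (s≤s k<n))))
          (+-identityˡ 0#)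

  Σ≤-zero : ∀ n g → (∀ k → k ℕ.≤ n → g k ≈ 0#) → Σ≤ n g ≈ 0#
  Σ≤-zero n g g≈0 = sum-vanishes g (λ k → k) (suc n) (λ k k<1+n → g≈0 k (s≤s⁻¹ k<1+n))

  Σ≤-head : ∀ n g → (∀ k → k < n → g (suc k) ≈ 0#) → Σ≤ n g ≈ g 0
  Σ≤-head n g tail≈0 = trans (+-congˡ (sum-vanishes g suc n tail≈0)) (+-identityʳ _)

  coef-· : ∀ f g {n} → n < p → coef (f · g) n ≡ Σ≤ n (λ i → coef f i * coef g (n ∸ i))
  coef-· f g n<p = ≡.trans (coef-< (f · g) n<p)
    (cong (λ n′ → Σ≤ n′ (λ i → coef f i * coef g (n′ ∸ i))) (toℕ-fromℕ< n<p))

  ·-u^-at : ∀ f {t} → t < p → coef (f · u^ t) t ≈ coef f 0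
  ·-u^-at f {t} t<p = begin
    coef (f · u^ t) t                            ≡⟨ coef-· f (u^ t) t<p ⟩
    Σ≤ t (λ i → coef f i * coef (u^ t) (t ∸ i))  ≈⟨ Σ≤-head t _ tail≈0 ⟩
    coef f 0 * coef (u^ t) t                     ≈⟨ *-congˡ (coef-u^-on t<p) ⟩
    coef f 0 * 1#                                ≈⟨ *-identityʳ _ ⟩
    coef f 0                                     ∎
    where
    tail≈0 : ∀ k → k < t → coef f (suc k) * coef (u^ t) (t ∸ suc k) ≈ 0#
    tail≈0 k k<t = trans (*-congˡ (coef-u^-off (λ e → <-irrefl e (∸-monoʳ-< (s≤s z≤n) k<t)))) (zeroʳ _)

  ·-u^-below : ∀ f {n t} → n < t → t < p → coef (f · u^ t) n ≈ 0#
  ·-u^-below f {n} {t} n<t t<p = begin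
    coef (f · u^ t) n                            ≡⟨ coef-· f (u^ t) (<-trans n<t t<p) ⟩
    Σ≤ n (λ i → coef f i * coef (u^ t) (n ∸ i))  ≈⟨ Σ≤-zero n _ term≈0 ⟩
    0#                                           ∎
    where
    term≈0 : ∀ k → k ℕ.≤ n → coef f k * coef (u^ t) (n ∸ k) ≈ 0#
    term≈0 k _ = trans (*-congˡ (coef-u^-off (λ e → <-irrefl e (≤-<-trans (m∸n≤m n k) n<t)))) (zeroʳ _)

  const-· : ∀ x f m → (const x · f) m ≈ x * f m
  const-· x f m = begin
    (const x · f) m     ≈⟨ Σ≤-head (toℕ m) _ (λ k _ → trans (*-congʳ (coef-const-suc x k)) (zeroˡ _)) ⟩
    x * coef f (toℕ m)  ≡⟨ cong (x *_) (coef-toℕ f m) ⟩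
    x * f m             ∎

  ·-𝟎 : ∀ f m → (f · 𝟎) m ≈ 0#
  ·-𝟎 f m = Σ≤-zero (toℕ m) _ (λ k _ → trans (*-congˡ (coef-𝟎 (toℕ m ∸ k))) (zeroʳ _))

  ·-constant-term : ∀ f g → (f · g) Fin.zero ≈ f Fin.zero * g Fin.zero
  ·-constant-term f g = +-identityʳ _

  app-constant-term : ∀ M x k → app M x k Fin.zero ≈ Σ₃ (λ l → M k l Fin.zero * x l Fin.zero)
  app-constant-term M x k = Σ₃-cong (λ l → ·-constant-term (M k l) (x l))

  basis : ℕ → Fin 3 → 𝓜
  basis t l k = δ l k (u^ t) 𝟎

  app-basis : ∀ M t l k m → app M (basis t l) k m ≈ (M k l · u^ t) m
  app-basis M t l k m = begin
    Σ₃ (λ l′ → (M k l′ · basis t l l′) m)  ≈⟨ Σ₃-concentrated l off ⟩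
    (M k l · basis t l l) m               ≡⟨ cong (λ v → (M k l · v) m) (δ-on {l = l} {l} {u^ t} {𝟎} ≡.refl) ⟩
    (M k l · u^ t) m                      ∎
    where
    off : ∀ l′ → l′ ≢ l → (M k l′ · basis t l l′) m ≈ 0#
    off l′ l′≢l = trans (reflexive (cong (λ v → (M k l′ · v) m) (δ-off (λ e → l′≢l (≡.sym e)))))
                        (·-𝟎 (M k l′) m)

  app-basis-at : ∀ M {t} l k → t < p → coef (app M (basis t l) k) t ≈ M k l Fin.zero
  app-basis-at M {t} l k t<p = trans (coef-cong (app-basis M t l k) t) (·-u^-at (M k l) t<p)

  app-basis-below : ∀ M {n t} l k → n < t → t < p → coef (app M (basis t l) k) n ≈ 0#
  app-basis-below M {n} {t} l k n<t t<p =
    trans (coef-cong (app-basis M t l k) n) (·-u^-below (M k l) n<t t<p)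

  -- 𝓜₂ is generated by u^(deg l) E_l.
  deg : Fin 3 → ℕ
  deg ι₁ = 2
  deg ι₂ = 1
  deg ι₃ = 0

  deg<p : ∀ l → deg l < p
  deg<p ι₁ = s≤s (s≤s (s≤s z≤n))
  deg<p ι₂ = s≤s (s≤s z≤n)
  deg<p ι₃ = s≤s z≤n

  deg-injective : ∀ {k l} → deg k ≡ deg l → k ≡ l
  deg-injective {ι₁} {ι₁} _ = ≡.refl
  deg-injective {ι₂} {ι₂} _ = ≡.refl
  deg-injective {ι₃} {ι₃} _ = ≡.refl
  deg-injective {ι₁} {ι₂} ()
  deg-injective {ι₁} {ι₃} ()
  deg-injective {ι₂} {ι₁} ()
  deg-injective {ι₂} {ι₃} ()
  deg-injective {ι₃} {ι₁} ()
  deg-injective {ι₃} {ι₂} ()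

  gen : Fin 3 → 𝓜
  gen l = basis (deg l) l

  gen∈𝓜₂ : ∀ l → In𝓜₂ (gen l)
  gen∈𝓜₂ ι₁ = refl , refl , refl
  gen∈𝓜₂ ι₂ = refl , refl , refl
  gen∈𝓜₂ ι₃ = refl , refl , refl

  In𝓜₂-low : ∀ {x} → In𝓜₂ x → ∀ k {n} → n < deg k → coef (x k) n ≈ 0#
  In𝓜₂-low (x₁[0]≈0 , _ , _) ι₁ {0} _ = x₁[0]≈0
  In𝓜₂-low (_ , x₁[1]≈0 , _) ι₁ {1} _ = x₁[1]≈0
  In𝓜₂-low (_ , _ , x₂[0]≈0) ι₂ {0} _ = x₂[0]≈0
  In𝓜₂-low _ ι₁ {suc (suc _)} (s≤s (s≤s ()))
  In𝓜₂-low _ ι₂ {suc _} (s≤s ())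
  In𝓜₂-low _ ι₃ ()

  -- The coordinate of x along the generator u^(deg l) E_l.
  lead : 𝓜 → Fin 3 → Carrier
  lead x l = coef (x l) (deg l)

  lead-gen-on : ∀ l → lead (gen l) l ≈ 1#
  lead-gen-on l = trans (reflexive (cong (λ v → coef v (deg l)) (δ-on {l = l} {l} {u^ deg l} {𝟎} ≡.refl)))
                        (coef-u^-on (deg<p l))

  lead-gen-off : ∀ {l l′} → l′ ≢ l → lead (gen l) l′ ≈ 0#
  lead-gen-off {l} {l′} l′≢l =
    trans (reflexive (cong (λ v → coef v (deg l′)) (δ-off {l = l} {l′} {u^ deg l} {𝟎} (λ e → l′≢l (≡.sym e)))))
          (coef-𝟎 (deg l′))

  constTerms : Mat → Fin 3 → Fin 3 → Carrier
  constTerms M k l = M k l Fin.zero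

  Triangular : (Fin 3 → Fin 3 → Carrier) → Set ℓ
  Triangular P = ∀ k l → deg l < deg k → P k l ≈ 0#

  -- A matrix preserving 𝓜₂ has triangular constant terms: A(u^(deg l) E_l) has
  -- coefficient A_kl(0) in degree deg l of its k-th component.
  preserves𝓜₂⇒triangular : ∀ M → (∀ x → In𝓜₂ x → In𝓜₂ (app M x)) → Triangular (constTerms M)
  preserves𝓜₂⇒triangular M pres k l dl<dk = begin
    M k l Fin.zero                  ≈⟨ app-basis-at M l k (deg<p l) ⟨
    coef (app M (gen l) k) (deg l)  ≈⟨ In𝓜₂-low {app M (gen l)} (pres (gen l) (gen∈𝓜₂ l)) k dl<dk ⟩
    0#                              ∎

  triangular-diagonal : ∀ {P Q} → Triangular P → Triangular Q → ∀ l →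
                        Σ₃ (λ k → P l k * Q k l) ≈ P l l * Q l l
  triangular-diagonal {P} {Q} P-tri Q-tri l = Σ₃-concentrated l off
    where
    off : ∀ k → k ≢ l → P l k * Q k l ≈ 0#
    off k k≢l with <-cmp (deg k) (deg l)
    ... | tri< dk<dl _ _ = trans (*-congʳ (P-tri l k dk<dl)) (zeroˡ _)
    ... | tri≈ _ dk≡dl _ = ⊥-elim (k≢l (deg-injective dk≡dl))
    ... | tri> _ _ dl<dk = trans (*-congˡ (Q-tri k l dl<dk)) (zeroʳ _)

  inverse⇒diagonal-units : ∀ A B → Triangular (constTerms A) → Triangular (constTerms B) →
                           (∀ x → app B (app A x) ≋ x) → ∀ l → B l l Fin.zero * A l l Fin.zero ≈ 1#
  inverse⇒diagonal-units A B A-tri B-tri BA≋id l = begin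
    B l l Fin.zero * A l l Fin.zero                        ≈⟨ triangular-diagonal B-tri A-tri l ⟨
    Σ₃ (λ k → B l k Fin.zero * A k l Fin.zero)             ≈⟨ Σ₃-cong (λ k → *-congˡ {B l k Fin.zero} (app-basis-at A {0} l k (s≤s z≤n))) ⟨
    Σ₃ (λ k → B l k Fin.zero * app A (basis 0 l) k Fin.zero) ≈⟨ app-constant-term B (app A (basis 0 l)) l ⟨
    app B (app A (basis 0 l)) l Fin.zero                   ≈⟨ BA≋id (basis 0 l) l Fin.zero ⟩
    basis 0 l l Fin.zero                                   ≡⟨ cong (λ v → v Fin.zero) (δ-on {l = l} {l} {u^ 0} {𝟎} ≡.refl) ⟩
    1#                                                     ∎

  -- The weights w = (a,b,c') of 𝓜(s^i,a,b,c'). Its Frobenius φ₂ sends x to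
  -- Σ_l lead x l · w_l · E_{s^i(l)}; by definition this is the following sum, up to bracketing.
  weights : Carrier → Carrier → Carrier → Fin 3 → Carrier
  weights a b c' ι₁ = a
  weights a b c' ι₂ = b
  weights a b c' ι₃ = c'

  φ₂-constant-term : ∀ i a b c' x k →
    φ₂ i a b c' x k Fin.zero ≈ Σ₃ (λ l → δ (s^ i l) k (lead x l * weights a b c' l) 0#)
  φ₂-constant-term i a b c' x k = sym (+-assoc _ _ _)

  -- Since s^ i is a bijection, the k-th coordinate of φ₂ x comes from the generator s^⁻¹ i k.
  φ₂-component : ∀ i a b c' x k →
    φ₂ i a b c' x k Fin.zero ≈ lead x (s^⁻¹ i k) * weights a b c' (s^⁻¹ i k)
  φ₂-component i a b c' x k = begin
    φ₂ i a b c' x k Fin.zero                                     ≈⟨ φ₂-constant-term i a b c' x k ⟩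
    Σ₃ (λ l → δ (s^ i l) k (lead x l * w l) 0#)                  ≈⟨ Σ₃-concentrated l₀ off ⟩
    δ (s^ i l₀) k (lead x l₀ * w l₀) 0#                          ≡⟨ δ-on (s^-s^⁻¹ i k) ⟩
    lead x l₀ * w l₀                                             ∎
    where
    w : Fin 3 → Carrier
    w = weights a b c'
    l₀ : Fin 3
    l₀ = s^⁻¹ i k
    off : ∀ l → l ≢ l₀ → δ (s^ i l) k (lead x l * w l) 0# ≈ 0#
    off l l≢l₀ = reflexive (δ-off (λ e → l≢l₀ (≡.trans (≡.sym (s^⁻¹-s^ i l)) (cong (s^⁻¹ i) e))))

  app-φ₂-gen : ∀ A i a b c' l →
    app A (φ₂ i a b c' (gen l)) (s^ i l) Fin.zero ≈ A (s^ i l) (s^ i l) Fin.zero * weights a b c' l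
  app-φ₂-gen A i a b c' l = begin
    app A (φ₂ i a b c' (gen l)) k Fin.zero                 ≈⟨ app-constant-term A (φ₂ i a b c' (gen l)) k ⟩
    Σ₃ (λ m → A k m Fin.zero * φ₂ i a b c' (gen l) m Fin.zero)
      ≈⟨ Σ₃-cong (λ m → *-congˡ {A k m Fin.zero} (φ₂-component i a b c' (gen l) m)) ⟩
    Σ₃ (λ m → A k m Fin.zero * g (s^⁻¹ i m))                ≈⟨ Σ₃-concentrated k off ⟩
    A k k Fin.zero * g (s^⁻¹ i k)                           ≡⟨ cong (λ l′ → A k k Fin.zero * g l′) (s^⁻¹-s^ i l) ⟩
    A k k Fin.zero * (lead (gen l) l * w l)                 ≈⟨ *-congˡ (trans (*-congʳ (lead-gen-on l)) (*-identityˡ _)) ⟩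
    A k k Fin.zero * w l                                    ∎
    where
    k : Fin 3
    k = s^ i l
    w : Fin 3 → Carrier
    w = weights a b c'
    g : Fin 3 → Carrier
    g l′ = lead (gen l) l′ * w l′
    off : ∀ m → m ≢ k → A k m Fin.zero * g (s^⁻¹ i m) ≈ 0#
    off m m≢k = trans (*-congˡ (trans (*-congʳ (lead-gen-off s^⁻¹m≢l)) (zeroˡ _))) (zeroʳ _)
      where
      s^⁻¹m≢l : s^⁻¹ i m ≢ l
      s^⁻¹m≢l e = m≢k (≡.trans (≡.sym (s^-s^⁻¹ i m)) (cong (s^ i) e))

  -- The basic constraint on a morphism A : 𝓜(s^i,a,b,c') → 𝓜(s^j,α,β,γ), obtained by
  -- comparing A ∘ φ₂ and φ₂ ∘ A on the generator u^(deg l) E_l at coordinate s^i l.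
  morphism-relation : ∀ {i a b c' j α β γ} A → IsMorphism i a b c' j α β γ A → ∀ l →
    A (s^ i l) (s^ i l) Fin.zero * weights a b c' l
      ≈ lead (app A (gen l)) (s^⁻¹ j (s^ i l)) * weights α β γ (s^⁻¹ j (s^ i l))
  morphism-relation {i} {a} {b} {c'} {j} {α} {β} {γ} A (_ , φ₂-commutes , _) l = begin
    A (s^ i l) (s^ i l) Fin.zero * weights a b c' l  ≈⟨ app-φ₂-gen A i a b c' l ⟨
    app A (φ₂ i a b c' (gen l)) (s^ i l) Fin.zero    ≈⟨ φ₂-commutes (gen l) (gen∈𝓜₂ l) (s^ i l) Fin.zero ⟩
    φ₂ j α β γ (app A (gen l)) (s^ i l) Fin.zero     ≈⟨ φ₂-component j α β γ (app A (gen l)) (s^ i l) ⟩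
    lead (app A (gen l)) (s^⁻¹ j (s^ i l)) * weights α β γ (s^⁻¹ j (s^ i l)) ∎

  DiagonalMorphism : ℕ → (d w ω : Fin 3 → Carrier) → Set ℓ
  DiagonalMorphism i d w ω = ∀ l → d (s^ i l) * w l ≈ d l * ω l

  diagonalConsts : Mat → Fin 3 → Carrier
  diagonalConsts A l = A l l Fin.zero

  morphism⇒diagonal : ∀ {i a b c' α β γ} A → IsMorphism i a b c' i α β γ A →
    DiagonalMorphism i (diagonalConsts A) (weights a b c') (weights α β γ)
  morphism⇒diagonal {i} {a} {b} {c'} {α} {β} {γ} A mor l = begin
    A (s^ i l) (s^ i l) Fin.zero * weights a b c' l                          ≈⟨ morphism-relation {i} {a} {b} {c'} {i} {α} {β} {γ} A mor l ⟩
    lead (app A (gen l)) (s^⁻¹ i (s^ i l)) * weights α β γ (s^⁻¹ i (s^ i l))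
      ≡⟨ cong (λ l′ → lead (app A (gen l)) l′ * weights α β γ l′) (s^⁻¹-s^ i l) ⟩
    lead (app A (gen l)) l * weights α β γ l                                 ≈⟨ *-congʳ (app-basis-at A l l (deg<p l)) ⟩
    A l l Fin.zero * weights α β γ l                                         ∎

  -- Multiplying the relations over all l and cancelling Π d (s^ i permutes the factors):
  -- an invertible diagonal morphism preserves the product of the weights.
  diagonal⇒Π : ∀ {i d w ω} → DiagonalMorphism i d w ω → (∀ l → ¬ (d l ≈ 0#)) → Π₃ w ≈ Π₃ ω
  diagonal⇒Π {i} {d} {w} {ω} rel d≉0 = *-cancelˡ (Π₃-nonzero d≉0) (begin
    Π₃ d * Π₃ w                   ≈⟨ *-congʳ (Π₃-s^ i d) ⟨
    Π₃ (λ l → d (s^ i l)) * Π₃ w  ≈⟨ Π₃-* (λ l → d (s^ i l)) w ⟨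
    Π₃ (λ l → d (s^ i l) * w l)   ≈⟨ Π₃-cong rel ⟩
    Π₃ (λ l → d l * ω l)          ≈⟨ Π₃-* d ω ⟩
    Π₃ d * Π₃ ω                   ∎)

  s^ι₁-injective : ∀ {i j} → OneOrTwo i → OneOrTwo j → s^ i ι₁ ≡ s^ j ι₁ → i ≡ j
  s^ι₁-injective (inj₁ ≡.refl) (inj₁ ≡.refl) _ = ≡.refl
  s^ι₁-injective (inj₂ ≡.refl) (inj₂ ≡.refl) _ = ≡.refl
  s^ι₁-injective (inj₁ ≡.refl) (inj₂ ≡.refl) ()
  s^ι₁-injective (inj₂ ≡.refl) (inj₁ ≡.refl) ()

  deg<deg-ι₁ : ∀ {l} → l ≢ ι₁ → deg l < deg ι₁
  deg<deg-ι₁ {ι₁} l≢ι₁ = ⊥-elim (l≢ι₁ ≡.refl)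
  deg<deg-ι₁ {ι₂} _ = s≤s (s≤s z≤n)
  deg<deg-ι₁ {ι₃} _ = s≤s z≤n

  -- For i ≠ j in {1,2}, a morphism 𝓜(s^i,a,b,c') → 𝓜(s^j,α,β,γ) sees the generator
  -- u²E₁ land on a coordinate of lower degree, which forces A_kk(0) a = 0 for k = s^i(1).
  crossed-morphism : ∀ {i a b c' j α β γ} A → i ≢ j → OneOrTwo i → OneOrTwo j →
    IsMorphism i a b c' j α β γ A → A (s^ i ι₁) (s^ i ι₁) Fin.zero * a ≈ 0#
  crossed-morphism {i} {a} {b} {c'} {j} {α} {β} {γ} A i≢j i∈12 j∈12 mor =
    trans (morphism-relation {i} {a} {b} {c'} {j} {α} {β} {γ} A mor ι₁)
          (trans (*-congʳ (app-basis-below A ι₁ l′ (deg<deg-ι₁ l′≢ι₁) (deg<p ι₁))) (zeroˡ _))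
    where
    l′ : Fin 3
    l′ = s^⁻¹ j (s^ i ι₁)
    l′≢ι₁ : l′ ≢ ι₁
    l′≢ι₁ e = i≢j (s^ι₁-injective i∈12 j∈12 (≡.trans (≡.sym (s^-s^⁻¹ j (s^ i ι₁))) (cong (s^ j) e)))

  diag : (Fin 3 → Carrier) → Mat
  diag d k l = const (δ k l (d k) 0#)

  app-diag : ∀ d x k m → app (diag d) x k m ≈ d k * x k m
  app-diag d x k m = begin
    Σ₃ (λ l → (diag d k l · x l) m)    ≈⟨ Σ₃-cong (λ l → const-· (δ k l (d k) 0#) (x l) m) ⟩
    Σ₃ (λ l → δ k l (d k) 0# * x l m)  ≈⟨ Σ₃-concentrated k off ⟩
    δ k k (d k) 0# * x k m             ≡⟨ cong (_* x k m) (δ-on {l = k} {k} {d k} {0#} ≡.refl) ⟩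
    d k * x k m                        ∎
    where
    off : ∀ l → l ≢ k → δ k l (d k) 0# * x l m ≈ 0#
    off l l≢k = trans (*-congʳ (reflexive (δ-off (λ e → l≢k (≡.sym e))))) (zeroˡ _)

  coef-diag : ∀ d x k n → coef (app (diag d) x k) n ≈ d k * coef (x k) n
  coef-diag d x k = coef-scale (d k) (app-diag d x k)

  diag-preserves-𝓜₂ : ∀ d x → In𝓜₂ x → In𝓜₂ (app (diag d) x)
  diag-preserves-𝓜₂ d x (x₁[0]≈0 , x₁[1]≈0 , x₂[0]≈0) =
    vanishes ι₁ 0 x₁[0]≈0 , vanishes ι₁ 1 x₁[1]≈0 , vanishes ι₂ 0 x₂[0]≈0
    where
    vanishes : ∀ k n → coef (x k) n ≈ 0# → coef (app (diag d) x k) n ≈ 0#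
    vanishes k n x≈0 = trans (coef-diag d x k n) (trans (*-congˡ x≈0) (zeroʳ _))

  diag-commutes-φ₂ : ∀ {i a b c' α β γ} d → DiagonalMorphism i d (weights a b c') (weights α β γ) →
                     ∀ x → app (diag d) (φ₂ i a b c' x) ≋ φ₂ i α β γ (app (diag d) x)
  diag-commutes-φ₂ {i} {a} {b} {c'} d rel x k (Fin.suc m) =
    trans (app-diag d (φ₂ i a b c' x) k (Fin.suc m)) (zeroʳ (d k))
  diag-commutes-φ₂ {i} {a} {b} {c'} {α} {β} {γ} d rel x k Fin.zero = begin
    app (diag d) (φ₂ i a b c' x) k Fin.zero  ≈⟨ app-diag d (φ₂ i a b c' x) k Fin.zero ⟩
    d k * φ₂ i a b c' x k Fin.zero           ≈⟨ *-congˡ (φ₂-component i a b c' x k) ⟩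
    d k * (lead x l * w l)                   ≈⟨ x∙yz≈y∙xz (d k) (lead x l) (w l) ⟩
    lead x l * (d k * w l)                   ≡⟨ cong (λ k′ → lead x l * (d k′ * w l)) (≡.sym (s^-s^⁻¹ i k)) ⟩
    lead x l * (d (s^ i l) * w l)            ≈⟨ *-congˡ (rel l) ⟩
    lead x l * (d l * ω l)                   ≈⟨ x∙yz≈y∙xz (lead x l) (d l) (ω l) ⟩
    d l * (lead x l * ω l)                   ≈⟨ *-assoc (d l) (lead x l) (ω l) ⟨
    (d l * lead x l) * ω l                   ≈⟨ *-congʳ (coef-diag d x l (deg l)) ⟨
    lead (app (diag d) x) l * ω l            ≈⟨ φ₂-component i α β γ (app (diag d) x) k ⟨
    φ₂ i α β γ (app (diag d) x) k Fin.zero   ∎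
    where
    l : Fin 3
    l = s^⁻¹ i k
    w : Fin 3 → Carrier
    w = weights a b c'
    ω : Fin 3 → Carrier
    ω = weights α β γ

  •≡× : ∀ n x → n • x ≡ n ×ᴿ x
  •≡× zero x = ≡.refl
  •≡× (suc n) x = cong (x +_) (•≡× n x)

  diag-commutes-N : ∀ d x → app (diag d) (N x) ≋ N (app (diag d) x)
  diag-commutes-N d x k m = begin
    app (diag d) (N x) k m                   ≈⟨ app-diag d (N x) k m ⟩
    d k * - (toℕ m • x k m)                  ≈⟨ -‿distribʳ-* (d k) _ ⟨
    - (d k * (toℕ m • x k m))                ≡⟨ cong (λ y → - (d k * y)) (•≡× (toℕ m) (x k m)) ⟩
    - (d k * (toℕ m ×ᴿ x k m))               ≈⟨ -‿cong (×-comm-* (toℕ m) (d k) (x k m)) ⟩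
    - (toℕ m ×ᴿ (d k * x k m))               ≈⟨ -‿cong (×-congʳ (toℕ m) (app-diag d x k m)) ⟨
    - (toℕ m ×ᴿ app (diag d) x k m)          ≡⟨ cong -_ (•≡× (toℕ m) (app (diag d) x k m)) ⟨
    N (app (diag d) x) k m                   ∎

  diag-morphism : ∀ {i a b c' α β γ} d → DiagonalMorphism i d (weights a b c') (weights α β γ) →
                  IsMorphism i a b c' i α β γ (diag d)
  diag-morphism {i} {a} {b} {c'} {α} {β} {γ} d rel =
    diag-preserves-𝓜₂ d , (λ x _ → diag-commutes-φ₂ {i} {a} {b} {c'} {α} {β} {γ} d rel x) , diag-commutes-N d

  diag-inverse : ∀ d e → (∀ k → e k * d k ≈ 1#) → ∀ x → app (diag e) (app (diag d) x) ≋ x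
  diag-inverse d e ed≈1 x k m = begin
    app (diag e) (app (diag d) x) k m  ≈⟨ app-diag e (app (diag d) x) k m ⟩
    e k * app (diag d) x k m           ≈⟨ *-congˡ (app-diag d x k m) ⟩
    e k * (d k * x k m)                ≈⟨ *-assoc (e k) (d k) (x k m) ⟨
    (e k * d k) * x k m                ≈⟨ *-congʳ (ed≈1 k) ⟩
    1# * x k m                         ≈⟨ *-identityˡ (x k m) ⟩
    x k m                              ∎

  diagonal-inverse : ∀ {i d e w ω} → DiagonalMorphism i d w ω → (∀ l → d l * e l ≈ 1#) →
                     DiagonalMorphism i e ω w
  diagonal-inverse {i} {d} {e} {w} {ω} rel de≈1 l = begin
    e′ * ω l                    ≈⟨ *-identityʳ _ ⟨
    (e′ * ω l) * 1#             ≈⟨ *-congˡ (de≈1 l) ⟨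
    (e′ * ω l) * (d l * e l)    ≈⟨ solve 4 (λ e′ ω d e₀ → (e′ :* ω) :* (d :* e₀) := (e′ :* e₀) :* (d :* ω)) refl e′ (ω l) (d l) (e l) ⟩
    (e′ * e l) * (d l * ω l)    ≈⟨ *-congˡ (rel l) ⟨
    (e′ * e l) * (d′ * w l)     ≈⟨ solve 4 (λ e′ e₀ d′ w → (e′ :* e₀) :* (d′ :* w) := (e₀ :* w) :* (d′ :* e′)) refl e′ (e l) d′ (w l) ⟩
    (e l * w l) * (d′ * e′)     ≈⟨ *-congˡ (de≈1 (s^ i l)) ⟩
    (e l * w l) * 1#            ≈⟨ *-identityʳ _ ⟩
    e l * w l                   ∎
    where
    d′ : Carrier
    d′ = d (s^ i l)
    e′ : Carrier
    e′ = e (s^ i l)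

  diagonal-isomorphism : ∀ {i a b c' α β γ} d → (∀ l → ¬ (d l ≈ 0#)) →
    DiagonalMorphism i d (weights a b c') (weights α β γ) → Isomorphic i a b c' i α β γ
  diagonal-isomorphism {i} {a} {b} {c'} {α} {β} {γ} d d≉0 rel =
    diag d , diag e ,
    diag-morphism {i} {a} {b} {c'} {α} {β} {γ} d rel ,
    diag-morphism {i} {α} {β} {γ} {a} {b} {c'} e (diagonal-inverse {i} {d} {e} rel de≈1) ,
    diag-inverse d e (λ k → trans (*-comm (e k) (d k)) (de≈1 k)) , diag-inverse e d de≈1
    where
    e : Fin 3 → Carrier
    e l = d l ⁻¹⟨ d≉0 l ⟩
    de≈1 : ∀ l → d l * e l ≈ 1#
    de≈1 l = ⁻¹-inverse (d l) (d≉0 l)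

  isomorphism⇒diagonal-nonzero : ∀ A B → (∀ x → In𝓜₂ x → In𝓜₂ (app A x)) → (∀ x → In𝓜₂ x → In𝓜₂ (app B x)) →
    (∀ x → app B (app A x) ≋ x) → ∀ l → ¬ (A l l Fin.zero ≈ 0#)
  isomorphism⇒diagonal-nonzero A B presA presB BA≋id l = unit⇒nonzero
    (inverse⇒diagonal-units A B (preserves𝓜₂⇒triangular A presA) (preserves𝓜₂⇒triangular B presB) BA≋id l)

  isomorphic⇒equal : ∀ i j a b c' α β γ → OneOrTwo i → OneOrTwo j → ¬ (a ≈ 0#) →
    Isomorphic i a b c' j α β γ → i ≡ j × (a * b) * c' ≈ (α * β) * γ
  isomorphic⇒equal i j a b c' α β γ i∈12 j∈12 a≉0 (A , B , morA , morB , BA≋id , _) with i ℕ.≟ j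
  ... | yes ≡.refl = ≡.refl ,
    diagonal⇒Π {i} (morphism⇒diagonal {i} {a} {b} {c'} {α} {β} {γ} A morA)
               (isomorphism⇒diagonal-nonzero A B (proj₁ morA) (proj₁ morB) BA≋id)
  ... | no i≢j = ⊥-elim (a≉0 (no-zero-divisors
    (isomorphism⇒diagonal-nonzero A B (proj₁ morA) (proj₁ morB) BA≋id (s^ i ι₁))
    (crossed-morphism {i} {a} {b} {c'} {j} {α} {β} {γ} A i≢j i∈12 j∈12 morA)))

  coboundary : ∀ {i r} → OneOrTwo i → (∀ l → ¬ (r l ≈ 0#)) → Π₃ r ≈ 1# →
    Σ (Fin 3 → Carrier) λ d → (∀ l → ¬ (d l ≈ 0#)) × (∀ l → d (s^ i l) ≈ d l * r l)
  coboundary {r = r} (inj₁ ≡.refl) r≉0 Πr≈1 = d , d≉0 , d-step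
    where
    d : Fin 3 → Carrier
    d ι₁ = 1#
    d ι₂ = r ι₁
    d ι₃ = r ι₁ * r ι₂
    d≉0 : ∀ l → ¬ (d l ≈ 0#)
    d≉0 ι₁ = 1≉0
    d≉0 ι₂ = r≉0 ι₁
    d≉0 ι₃ = nonzero-* (r≉0 ι₁) (r≉0 ι₂)
    d-step : ∀ l → d (s l) ≈ d l * r l
    d-step ι₁ = sym (*-identityˡ (r ι₁))
    d-step ι₂ = refl
    d-step ι₃ = sym Πr≈1
  coboundary {r = r} (inj₂ ≡.refl) r≉0 Πr≈1 = d , d≉0 , d-step
    where
    d : Fin 3 → Carrier
    d ι₁ = 1#
    d ι₂ = r ι₁ * r ι₃
    d ι₃ = r ι₁
    d≉0 : ∀ l → ¬ (d l ≈ 0#)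
    d≉0 ι₁ = 1≉0
    d≉0 ι₂ = nonzero-* (r≉0 ι₁) (r≉0 ι₃)
    d≉0 ι₃ = r≉0 ι₁
    d-step : ∀ l → d (s (s l)) ≈ d l * r l
    d-step ι₁ = sym (*-identityˡ (r ι₁))
    d-step ι₂ = sym (trans (*-assoc _ _ _) (trans (*-congˡ (*-comm _ _)) (trans (sym (*-assoc _ _ _)) Πr≈1)))
    d-step ι₃ = refl

  coboundary⇒diagonal : ∀ {i} {d r w ω : Fin 3 → Carrier} → (∀ l → d (s^ i l) ≈ d l * r l) → (∀ l → r l * w l ≈ ω l) →
                        DiagonalMorphism i d w ω
  coboundary⇒diagonal {i} {d} {r} {w} {ω} d-step rw≈ω l = begin
    d (s^ i l) * w l    ≈⟨ *-congʳ (d-step l) ⟩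
    (d l * r l) * w l   ≈⟨ *-assoc (d l) (r l) (w l) ⟩
    d l * (r l * w l)   ≈⟨ *-congˡ (rw≈ω l) ⟩
    d l * ω l           ∎

  weights-nonzero : ∀ {a b c'} → ¬ (a ≈ 0#) → ¬ (b ≈ 0#) → ¬ (c' ≈ 0#) → ∀ l → ¬ (weights a b c' l ≈ 0#)
  weights-nonzero a≉0 _ _ ι₁ = a≉0
  weights-nonzero _ b≉0 _ ι₂ = b≉0
  weights-nonzero _ _ c'≉0 ι₃ = c'≉0

  ratios : ∀ {w ω} → (∀ l → ¬ (w l ≈ 0#)) → (∀ l → ¬ (ω l ≈ 0#)) → Π₃ w ≈ Π₃ ω →
    Σ (Fin 3 → Carrier) λ r → (∀ l → ¬ (r l ≈ 0#)) × Π₃ r ≈ 1# × (∀ l → r l * w l ≈ ω l)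
  ratios {w} {ω} w≉0 ω≉0 Πw≈Πω = r , r≉0 , Πr≈1 , rw≈ω
    where
    r : Fin 3 → Carrier
    r l = ω l * w l ⁻¹⟨ w≉0 l ⟩
    r≉0 : ∀ l → ¬ (r l ≈ 0#)
    r≉0 l = nonzero-* (ω≉0 l) (unit⇒nonzero (⁻¹-inverse (w l) (w≉0 l)))
    rw≈ω : ∀ l → r l * w l ≈ ω l
    rw≈ω l = begin
      (ω l * w l ⁻¹⟨ w≉0 l ⟩) * w l  ≈⟨ *-assoc (ω l) _ (w l) ⟩
      ω l * (w l ⁻¹⟨ w≉0 l ⟩ * w l)  ≈⟨ *-congˡ (trans (*-comm _ (w l)) (⁻¹-inverse (w l) (w≉0 l))) ⟩
      ω l * 1#                       ≈⟨ *-identityʳ (ω l) ⟩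
      ω l                            ∎
    Πr≈1 : Π₃ r ≈ 1#
    Πr≈1 = *-cancelˡ (Π₃-nonzero w≉0) (begin
      Π₃ w * Π₃ r             ≈⟨ *-comm (Π₃ w) (Π₃ r) ⟩
      Π₃ r * Π₃ w             ≈⟨ Π₃-* r w ⟨
      Π₃ (λ l → r l * w l)    ≈⟨ Π₃-cong rw≈ω ⟩
      Π₃ ω                    ≈⟨ Πw≈Πω ⟨
      Π₃ w                    ≈⟨ *-identityʳ (Π₃ w) ⟨
      Π₃ w * 1#               ∎)

  equal-products⇒isomorphic : ∀ i a b c' α β γ → OneOrTwo i →
    (∀ l → ¬ (weights a b c' l ≈ 0#)) → (∀ l → ¬ (weights α β γ l ≈ 0#)) →
    (a * b) * c' ≈ (α * β) * γ → Isomorphic i a b c' i α β γ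
  equal-products⇒isomorphic i a b c' α β γ i∈12 w≉0 ω≉0 Πw≈Πω
    with ratios w≉0 ω≉0 Πw≈Πω
  ... | r , r≉0 , Πr≈1 , rw≈ω with coboundary i∈12 r≉0 Πr≈1
  ... | d , d≉0 , d-step =
    diagonal-isomorphism {i} {a} {b} {c'} {α} {β} {γ} d d≉0 (coboundary⇒diagonal {i} {d} {r} d-step rw≈ω)

lemma2p2 : {c ℓ : Level} (p : ℕ) → Prime p → p > 3 → (F : FiniteField p c ℓ) →
    let open FiniteField F in
    (i j : ℕ) → 1 ≤ i → i ≤ 2 → 1 ≤ j → j ≤ 2 →
    (a b c' α β γ : Carrier) →
    ¬ (a ≈ 0#) → ¬ (b ≈ 0#) → ¬ (c' ≈ 0#) → ¬ (α ≈ 0#) → ¬ (β ≈ 0#) → ¬ (γ ≈ 0#) →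
    (Breuil.Isomorphic p F i a b c' j α β γ → (i ≡ j × (a * b) * c' ≈ (α * β) * γ))
    × ((i ≡ j × (a * b) * c' ≈ (α * β) * γ) → Breuil.Isomorphic p F i a b c' j α β γ)
lemma2p2 zero _ () _
lemma2p2 (suc zero) _ (s≤s ()) _
lemma2p2 (suc (suc zero)) _ (s≤s (s≤s ())) _
lemma2p2 (suc (suc (suc q))) _ _ F i j 1≤i i≤2 1≤j j≤2 a b c' α β γ a≉0 b≉0 c'≉0 α≉0 β≉0 γ≉0 =
  isomorphic⇒equal i j a b c' α β γ (oneOrTwo 1≤i i≤2) (oneOrTwo 1≤j j≤2) a≉0 ,
  λ { (≡.refl , Πw≈Πω) → equal-products⇒isomorphic i a b c' α β γ (oneOrTwo 1≤i i≤2)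
                           (weights-nonzero a≉0 b≉0 c'≉0) (weights-nonzero α≉0 β≉0 γ≉0) Πw≈Πω }
  where open Development q F
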